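{- Let $S,T,V\subseteq\mathcal{D}$ be pairwise disjoint sets with $|T|\ge 1$ and $|V|\ge 1$. Then the following identities of Boolean polynomials hold: (Case 1) if $|T|=1$ and $|V|=1$: $[\![S.\mathbf{P}_{T\cup V}]\!]=[\![(S\cup T).\mathbf{P}_\emptyset\uplus(S\cup T\cup V).\mathbf{P}_\emptyset\uplus(S\cup V).\mathbf{P}_\emptyset]\!]$; (Case 2) if $|T|>1$ and $|V|=1$: $[\![S.\mathbf{P}_{T\cup V}]\!]=[\![S.\mathbf{P}_T\uplus(S\cup V).\mathbf{P}_T\uplus(S\cup V).\mathbf{P}_\emptyset]\!]$; (Case 3) if $|T|>1$ and $|V|>1$: $[\![S.\mathbf{P}_{T\cup V}]\!]=[\![\biguplus_{\widetilde{V}\in\mathbf{P}_V}(S\cup\widetilde{V}).\mathbf{P}_T\uplus S.\mathbf{P}_T\uplus S.\mathbf{P}_V]\!]$.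
   Context: Let $\mathcal{D}=\{x_1,\dots,x_n\}$ be a set of Boolean variables and consider Boolean polynomials in $\mathbb{F}_2[x_1,\dots,x_n]/(x_i^2-x_i: i\in[n])$. For $W\subseteq\mathcal{D}$ let $m_W=\prod_{x\in W}x$ ($m_\emptyset=1$). For $U\subseteq\mathcal{D}$ the modified power set is $\mathbf{P}_U=\{\emptyset\}$ if $U=\emptyset$ and $\mathbf{P}_U=\{A\subseteq U: A\neq\emptyset\}$ otherwise. A power term $S.\mathbf{P}_U$ (with $S,U\subseteq\mathcal{D}$, $S\cap U=\emptyset$, $|U|\neq 1$, $(S,U)\neq(\emptyset,\emptyset)$) denotes the family $\{S\cup A: A\in\mathbf{P}_U\}$ and has semantics $[\![S.\mathbf{P}_U]\!]=\sum_{A\in\mathbf{P}_U}m_{S\cup A}$. Power term polynomials are formal sums of power terms under a commutative, associative operator $\uplus$ (with $\pi\uplus\pi$ equal to the zero constant), with semantics $[\![\pi\uplus\rho]\!]=[\![\pi]\!]+[\![\rho]\!]$ (addition over $\mathbb{F}_2$); $\biguplus$ denotes an iterated $\uplus$. -}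

module Defs where

open import Data.Bool using (Bool; true; false; _xor_; if_then_else_; not)
open import Data.Bool.Properties renaming (_≟_ to _≟ᵇ_)
open import Data.Nat using (ℕ; zero; suc)
open import Data.List using (List; []; _∷_; _++_; map; concatMap; filterᵇ)
open import Data.Vec using (Vec; []; _∷_)
open import Data.Vec.Properties using (≡-dec)
open import Data.Fin using (Fin)
open import Data.Fin.Subset using (Subset; inside; outside; ⊥; _∪_; _∈_)
open import Data.Empty renaming (⊥ to Empty)
open import Relation.Nullary using (does)
open import Relation.Binary.PropositionalEquality using (_≡_)

-- Variables x_1..x_n are indexed by Fin n; a set W ⊆ D is a Subset n,
-- and represents the (multilinear) monomial m_W.

_≟ˢ_ : ∀ {n} (A B : Subset n) → Relation.Nullary.Dec (A ≡ B)
_≟ˢ_ = ≡-dec _≟ᵇ_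

Disjoint : ∀ {n} → Subset n → Subset n → Set
Disjoint A B = ∀ {x} → x ∈ A → x ∈ B → Empty

-- A Boolean polynomial in F2[x_1..x_n]/(x_i^2 - x_i) is written as a formal
-- sum of monomials m_W (a list of the sets W).
BoolPoly : ℕ → Set
BoolPoly n = List (Subset n)

coeff : ∀ {n} → BoolPoly n → Subset n → Bool
coeff []       W = false
coeff (M ∷ ms) W = does (M ≟ˢ W) xor coeff ms W

-- Equality of Boolean polynomials: all coefficients agree (the monomials
-- m_W, W ⊆ D, form a basis of the Boolean polynomial ring over F2).
_≈_ : ∀ {n} → BoolPoly n → BoolPoly n → Set
p ≈ q = ∀ W → coeff p W ≡ coeff q W

_+ᴾ_ : ∀ {n} → BoolPoly n → BoolPoly n → BoolPoly n
_+ᴾ_ = _++_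

subsetsOf : ∀ {n} → Subset n → List (Subset n)
subsetsOf {zero}  []              = [] ∷ []
subsetsOf {suc n} (outside ∷ U)   = map (outside ∷_) (subsetsOf U)
subsetsOf {suc n} (inside  ∷ U)   =
  map (outside ∷_) (subsetsOf U) ++ map (inside ∷_) (subsetsOf U)

P : ∀ {n} → Subset n → List (Subset n)
P U = if does (U ≟ˢ ⊥) then ⊥ ∷ []
      else filterᵇ (λ A → not (does (A ≟ˢ ⊥))) (subsetsOf U)

record PowerTerm (n : ℕ) : Set where
  constructor _∙P_
  field
    S : Subset n
    U : Subset n

infix 6 _∙P_

PTPoly : ℕ → Set
PTPoly n = List (PowerTerm n)

pt : ∀ {n} → PowerTerm n → PTPoly n
pt t = t ∷ []

infixr 5 _⊎ᵖ_
_⊎ᵖ_ : ∀ {n} → PTPoly n → PTPoly n → PTPoly n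
_⊎ᵖ_ = _++_

⨄ : ∀ {n} {A : Set} → List A → (A → PTPoly n) → PTPoly n
⨄ xs f = concatMap f xs

⟦_⟧ᵗ : ∀ {n} → PowerTerm n → BoolPoly n
⟦ S ∙P U ⟧ᵗ = map (λ A → S ∪ A) (P U)

⟦_⟧ : ∀ {n} → PTPoly n → BoolPoly n
⟦ [] ⟧    = []
⟦ t ∷ π ⟧ = ⟦ t ⟧ᵗ +ᴾ ⟦ π ⟧

-- For U ≠ ∅ the power term X.P_U is the full sum Σ_{A ⊆ U} m_{X ∪ A} minus its A = ∅ term m_X.
-- When T and V are disjoint every subset of T ∪ V is uniquely B ∪ A with B ⊆ V and A ⊆ T, so
-- Σ_{A ⊆ T ∪ V} m_{S ∪ A} = Σ_{B ⊆ V} Σ_{A ⊆ T} m_{S ∪ B ∪ A}.  Writing every inner full sum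
-- back as a power term plus its base monomial, and using that Boolean polynomials have
-- characteristic 2, gives the third identity for all nonempty disjoint T and V.  The other two
-- are its specialisations: P_V = {V} when |V| = 1, and X.P_T is the monomial m_{X ∪ T} when |T| = 1.

module Submission where

open import Defs
open import Algebra.Bundles using (AbelianGroup)
open import Algebra.Structures using (IsAbelianGroup)
import Algebra.Properties.Group as GroupProperties
import Algebra.Solver.CommutativeMonoid as CommutativeMonoidSolver
open import Data.Bool using (Bool; true; false; _xor_; _∧_; not; T?)
open import Data.Bool.Properties
  using (xor-assoc; xor-comm; xor-same; ∧-zeroʳ; ∧-distribˡ-xor; ∨-identityʳ; ∨-zeroʳ)
  renaming (_≟_ to _≟ᵇ_)
open import Data.Fin.Subset using (Subset; inside; outside; ⊥; _∪_; _⊆_; ∣_∣)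
open import Data.Fin.Subset.Properties using (∪-identityʳ; ∪-assoc; ∪-comm; ∣⊥∣≡0; ⊆-antisym; ⊆-min; p⊆p∪q)
open import Data.List using (List; []; _∷_; _++_; map; concatMap; filterᵇ)
open import Data.List.Properties
  using (++-assoc; ++-identityˡ; ++-identityʳ; map-++; map-∘; map-cong; concatMap-cong;
         concatMap-map; concatMap-pure; concatMap-++; map-concatMap; filter-all; filter-++; ∷-injectiveʳ)
open import Data.List.Relation.Unary.All using (universal)
open import Data.Nat using (ℕ; zero; suc; _≤_; _<_)
open import Data.Nat.Properties using (suc-injective; ≤-reflexive)
open import Data.Product using (_×_; _,_)
open import Data.Vec using ([]; _∷_; here; there)
open import Function using (_∘_)
open import Level using (0ℓ)
open import Relation.Binary.Bundles using (Setoid)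
import Relation.Binary.Reasoning.Setoid as SetoidReasoning
open import Relation.Nullary using (does)
open import Relation.Nullary.Decidable using (dec-true; dec-false)
open import Relation.Binary.PropositionalEquality
  using (_≡_; _≢_; refl; sym; trans; cong; cong₂; subst; module ≡-Reasoning)

-- Proofs of _≈_ are functions into coeff, from which Agda cannot infer the polynomials;
-- the record _≋_ wraps _≈_ so that it can.

record _≋_ {n} (p q : BoolPoly n) : Set where
  constructor ≈⇒≋
  field ≋⇒≈ : p ≈ q
open _≋_

infix 4 _≋_

≡⇒≋ : ∀ {n} {p q : BoolPoly n} → p ≡ q → p ≋ q
≡⇒≋ refl = ≈⇒≋ λ _ → refl

coeff-+ᴾ : ∀ {n} (p q : BoolPoly n) W → coeff (p +ᴾ q) W ≡ coeff p W xor coeff q W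
coeff-+ᴾ []      q W = refl
coeff-+ᴾ (M ∷ p) q W =
  trans (cong (does (M ≟ˢ W) xor_) (coeff-+ᴾ p q W)) (sym (xor-assoc (does (M ≟ˢ W)) _ _))

+ᴾ-cong : ∀ {n} {p q r s : BoolPoly n} → p ≋ q → r ≋ s → p +ᴾ r ≋ q +ᴾ s
+ᴾ-cong {p = p} {q} {r} {s} (≈⇒≋ p≈q) (≈⇒≋ r≈s) = ≈⇒≋ λ W →
  trans (coeff-+ᴾ p r W) (trans (cong₂ _xor_ (p≈q W) (r≈s W)) (sym (coeff-+ᴾ q s W)))

+ᴾ-comm : ∀ {n} (p q : BoolPoly n) → p +ᴾ q ≋ q +ᴾ p
+ᴾ-comm p q = ≈⇒≋ λ W →
  trans (coeff-+ᴾ p q W) (trans (xor-comm (coeff p W) _) (sym (coeff-+ᴾ q p W)))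

p+ᴾp≋[] : ∀ {n} (p : BoolPoly n) → p +ᴾ p ≋ []
p+ᴾp≋[] p = ≈⇒≋ λ W → trans (coeff-+ᴾ p p W) (xor-same (coeff p W))

+ᴾ-isAbelianGroup : ∀ n → IsAbelianGroup (_≋_ {n}) _+ᴾ_ [] (λ p → p)
+ᴾ-isAbelianGroup n = record
  { isGroup = record
    { isMonoid = record
      { isSemigroup = record
        { isMagma = record
          { isEquivalence = record
            { refl  = ≈⇒≋ λ _ → refl
            ; sym   = λ (≈⇒≋ p≈q) → ≈⇒≋ λ W → sym (p≈q W)
            ; trans = λ (≈⇒≋ p≈q) (≈⇒≋ q≈r) → ≈⇒≋ λ W → trans (p≈q W) (q≈r W)
            }
          ; ∙-cong = +ᴾ-cong
          }
        ; assoc = λ p q r → ≡⇒≋ (++-assoc p q r)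
        }
      ; identity = (λ p → ≡⇒≋ (++-identityˡ p)) , (λ p → ≡⇒≋ (++-identityʳ p))
      }
    ; inverse = p+ᴾp≋[] , p+ᴾp≋[]
    ; ⁻¹-cong = λ p≋q → p≋q
    }
  ; comm = +ᴾ-comm
  }

+ᴾ-abelianGroup : ℕ → AbelianGroup 0ℓ 0ℓ
+ᴾ-abelianGroup n = record { isAbelianGroup = +ᴾ-isAbelianGroup n }

≋-setoid : ℕ → Setoid 0ℓ 0ℓ
≋-setoid n = AbelianGroup.setoid (+ᴾ-abelianGroup n)

module PolySolver (n : ℕ) = CommutativeMonoidSolver (AbelianGroup.commutativeMonoid (+ᴾ-abelianGroup n))

coeff-map-∷ : ∀ {n} b (p : BoolPoly n) c W → coeff (map (b ∷_) p) (c ∷ W) ≡ does (b ≟ᵇ c) ∧ coeff p W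
coeff-map-∷ b []      c W = sym (∧-zeroʳ (does (b ≟ᵇ c)))
coeff-map-∷ b (M ∷ p) c W =
  trans (cong (does (b ≟ᵇ c) ∧ does (M ≟ˢ W) xor_) (coeff-map-∷ b p c W))
        (sym (∧-distribˡ-xor (does (b ≟ᵇ c)) _ _))

map-∷-cong : ∀ {n} b {p q : BoolPoly n} → p ≋ q → map (b ∷_) p ≋ map (b ∷_) q
map-∷-cong b {p} {q} (≈⇒≋ p≈q) = ≈⇒≋ λ where
  (c ∷ W) → trans (coeff-map-∷ b p c W)
                  (trans (cong (does (b ≟ᵇ c) ∧_) (p≈q W)) (sym (coeff-map-∷ b q c W)))

concatMap-+ᴾ : ∀ {n} {A : Set} (f g : A → BoolPoly n) xs →
  concatMap (λ x → f x +ᴾ g x) xs ≋ concatMap f xs +ᴾ concatMap g xs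
concatMap-+ᴾ {n} f g []       = ≡⇒≋ refl
concatMap-+ᴾ {n} f g (x ∷ xs) = begin
  (f x +ᴾ g x) +ᴾ concatMap (λ x → f x +ᴾ g x) xs
    ≈⟨ +ᴾ-cong (≡⇒≋ refl) (concatMap-+ᴾ f g xs) ⟩
  (f x +ᴾ g x) +ᴾ (concatMap f xs +ᴾ concatMap g xs)
    ≈⟨ solve 4 (λ a b c d → (a ⊕ b) ⊕ (c ⊕ d) ⊜ (a ⊕ c) ⊕ (b ⊕ d)) (≡⇒≋ refl)
               (f x) (g x) (concatMap f xs) (concatMap g xs) ⟩
  (f x +ᴾ concatMap f xs) +ᴾ (g x +ᴾ concatMap g xs) ∎
  where
  open SetoidReasoning (≋-setoid n)
  open PolySolver n using (solve; _⊜_; _⊕_; id)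

nonEmpty : ∀ {n} → Subset n → Bool
nonEmpty A = not (does (A ≟ˢ ⊥))

1≤∣p∣⇒p≢⊥ : ∀ {n} {p : Subset n} → 1 ≤ ∣ p ∣ → p ≢ ⊥
1≤∣p∣⇒p≢⊥ {n} 1≤∣p∣ refl with () ← subst (1 ≤_) (∣⊥∣≡0 n) 1≤∣p∣

p≢⊥⇒p∪q≢⊥ : ∀ {n} {p : Subset n} (q : Subset n) → p ≢ ⊥ → p ∪ q ≢ ⊥
p≢⊥⇒p∪q≢⊥ {p = p} q p≢⊥ p∪q≡⊥ = p≢⊥ (⊆-antisym (subst (p ⊆_) p∪q≡⊥ (p⊆p∪q q)) (⊆-min p))

∣p∣≡0⇒p≡⊥ : ∀ {n} {p : Subset n} → ∣ p ∣ ≡ 0 → p ≡ ⊥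
∣p∣≡0⇒p≡⊥ {p = []}          _     = refl
∣p∣≡0⇒p≡⊥ {p = outside ∷ p} ∣p∣≡0 = cong (outside ∷_) (∣p∣≡0⇒p≡⊥ ∣p∣≡0)

filterᵇ-map : ∀ {A B : Set} (q : B → Bool) (f : A → B) xs →
  filterᵇ q (map f xs) ≡ map f (filterᵇ (q ∘ f) xs)
filterᵇ-map q f []       = refl
filterᵇ-map q f (x ∷ xs) with q (f x)
... | true  = cong (f x ∷_) (filterᵇ-map q f xs)
... | false = filterᵇ-map q f xs

filterᵇ-nonEmpty-inside : ∀ {n} (L : List (Subset n)) →
  filterᵇ nonEmpty (map (inside ∷_) L) ≡ map (inside ∷_) L
filterᵇ-nonEmpty-inside L =
  trans (filterᵇ-map nonEmpty (inside ∷_) L)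
        (cong (map (inside ∷_)) (filter-all (T? ∘ λ _ → true) (universal _ L)))

subsetsOf≡⊥∷nonEmpty : ∀ {n} (U : Subset n) → subsetsOf U ≡ ⊥ ∷ filterᵇ nonEmpty (subsetsOf U)
subsetsOf≡⊥∷nonEmpty [] = refl
subsetsOf≡⊥∷nonEmpty (outside ∷ U) = begin
  map (outside ∷_) (subsetsOf U)
    ≡⟨ cong (map (outside ∷_)) (subsetsOf≡⊥∷nonEmpty U) ⟩
  ⊥ ∷ map (outside ∷_) (filterᵇ nonEmpty (subsetsOf U))
    ≡⟨ cong (⊥ ∷_) (filterᵇ-map nonEmpty (outside ∷_) (subsetsOf U)) ⟨
  ⊥ ∷ filterᵇ nonEmpty (map (outside ∷_) (subsetsOf U)) ∎
  where open ≡-Reasoning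
subsetsOf≡⊥∷nonEmpty (inside ∷ U) = begin
  map (outside ∷_) (subsetsOf U) ++ map (inside ∷_) (subsetsOf U)
    ≡⟨ cong (λ L → map (outside ∷_) L ++ map (inside ∷_) (subsetsOf U)) (subsetsOf≡⊥∷nonEmpty U) ⟩
  ⊥ ∷ map (outside ∷_) (filterᵇ nonEmpty (subsetsOf U)) ++ map (inside ∷_) (subsetsOf U)
    ≡⟨ cong₂ (λ L M → ⊥ ∷ L ++ M) (filterᵇ-map nonEmpty (outside ∷_) (subsetsOf U))
                                  (filterᵇ-nonEmpty-inside (subsetsOf U)) ⟨
  ⊥ ∷ filterᵇ nonEmpty (map (outside ∷_) (subsetsOf U)) ++ filterᵇ nonEmpty (map (inside ∷_) (subsetsOf U))
    ≡⟨ cong (⊥ ∷_) (filter-++ (T? ∘ nonEmpty) (map (outside ∷_) (subsetsOf U)) _) ⟨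
  ⊥ ∷ filterᵇ nonEmpty (subsetsOf (inside ∷ U)) ∎
  where open ≡-Reasoning

subsetsOf≡⊥∷P : ∀ {n} {U : Subset n} → U ≢ ⊥ → subsetsOf U ≡ ⊥ ∷ P U
subsetsOf≡⊥∷P {U = U} U≢⊥ rewrite dec-false (U ≟ˢ ⊥) U≢⊥ = subsetsOf≡⊥∷nonEmpty U

P-⊥ : ∀ n → P (⊥ {n}) ≡ ⊥ ∷ []
P-⊥ n rewrite dec-true (⊥ {n} ≟ˢ ⊥) refl = refl

subsetsOf-⊥ : ∀ n → subsetsOf (⊥ {n}) ≡ ⊥ ∷ []
subsetsOf-⊥ zero    = refl
subsetsOf-⊥ (suc n) = cong (map (outside ∷_)) (subsetsOf-⊥ n)

subsetsOf-singleton : ∀ {n} {V : Subset n} → ∣ V ∣ ≡ 1 → subsetsOf V ≡ ⊥ ∷ V ∷ []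
subsetsOf-singleton {V = outside ∷ V} ∣V∣≡1 = cong (map (outside ∷_)) (subsetsOf-singleton ∣V∣≡1)
subsetsOf-singleton {suc n} {V = inside ∷ V} ∣V∣≡1
  with refl ← ∣p∣≡0⇒p≡⊥ {p = V} (suc-injective ∣V∣≡1) =
  cong (λ L → map (outside ∷_) L ++ map (inside ∷_) L) (subsetsOf-⊥ n)

P-singleton : ∀ {n} {V : Subset n} → ∣ V ∣ ≡ 1 → P V ≡ V ∷ []
P-singleton ∣V∣≡1 =
  ∷-injectiveʳ (trans (sym (subsetsOf≡⊥∷P (1≤∣p∣⇒p≢⊥ (≤-reflexive (sym ∣V∣≡1)))))
                      (subsetsOf-singleton ∣V∣≡1))

powerSum : ∀ {n} → Subset n → Subset n → BoolPoly n
powerSum X U = map (X ∪_) (subsetsOf U)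

powerSumOver : ∀ {n} → Subset n → Subset n → List (Subset n) → BoolPoly n
powerSumOver S T = concatMap (λ B → powerSum (S ∪ B) T)

powerSum≡∷⟦∙P⟧ : ∀ {n} (X : Subset n) {U : Subset n} → U ≢ ⊥ → powerSum X U ≡ X ∷ ⟦ X ∙P U ⟧ᵗ
powerSum≡∷⟦∙P⟧ X {U} U≢⊥ =
  trans (cong (map (X ∪_)) (subsetsOf≡⊥∷P U≢⊥)) (cong (_∷ ⟦ X ∙P U ⟧ᵗ) (∪-identityʳ X))

map-∪-outside : ∀ {n} s (X : Subset n) L →
  map ((s ∷ X) ∪_) (map (outside ∷_) L) ≡ map (s ∷_) (map (X ∪_) L)
map-∪-outside s X L =
  trans (sym (map-∘ L)) (trans (map-cong (λ A → cong (_∷ (X ∪ A)) (∨-identityʳ s)) L) (map-∘ L))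

map-∪-inside : ∀ {n} s (X : Subset n) L →
  map ((s ∷ X) ∪_) (map (inside ∷_) L) ≡ map (inside ∷_) (map (X ∪_) L)
map-∪-inside s X L =
  trans (sym (map-∘ L)) (trans (map-cong (λ A → cong (_∷ (X ∪ A)) (∨-zeroʳ s)) L) (map-∘ L))

powerSum-outside : ∀ {n} s (X U : Subset n) → powerSum (s ∷ X) (outside ∷ U) ≡ map (s ∷_) (powerSum X U)
powerSum-outside s X U = map-∪-outside s X (subsetsOf U)

powerSum-inside : ∀ {n} s (X U : Subset n) →
  powerSum (s ∷ X) (inside ∷ U) ≡ map (s ∷_) (powerSum X U) +ᴾ map (inside ∷_) (powerSum X U)
powerSum-inside s X U =
  trans (map-++ _ (map (outside ∷_) (subsetsOf U)) _)
        (cong₂ _++_ (map-∪-outside s X (subsetsOf U)) (map-∪-inside s X (subsetsOf U)))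

powerSumOver-map-outside : ∀ {n} s (S : Subset n) t T L →
  powerSumOver (s ∷ S) (t ∷ T) (map (outside ∷_) L)
    ≡ concatMap (λ B → powerSum (s ∷ (S ∪ B)) (t ∷ T)) L
powerSumOver-map-outside s S t T L =
  trans (concatMap-map _ (outside ∷_) L)
        (concatMap-cong (λ B → cong (λ c → powerSum (c ∷ (S ∪ B)) (t ∷ T)) (∨-identityʳ s)) L)

powerSumOver-map-inside : ∀ {n} s (S : Subset n) t T L →
  powerSumOver (s ∷ S) (t ∷ T) (map (inside ∷_) L)
    ≡ concatMap (λ B → powerSum (inside ∷ (S ∪ B)) (t ∷ T)) L
powerSumOver-map-inside s S t T L =
  trans (concatMap-map _ (inside ∷_) L)
        (concatMap-cong (λ B → cong (λ c → powerSum (c ∷ (S ∪ B)) (t ∷ T)) (∨-zeroʳ s)) L)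

concatMap-powerSum-outside : ∀ {n} c (S T : Subset n) L →
  concatMap (λ B → powerSum (c ∷ (S ∪ B)) (outside ∷ T)) L ≡ map (c ∷_) (powerSumOver S T L)
concatMap-powerSum-outside c S T L =
  trans (concatMap-cong (λ B → powerSum-outside c (S ∪ B) T) L) (sym (map-concatMap (c ∷_) _ L))

concatMap-powerSum-inside : ∀ {n} c (S T : Subset n) L →
  concatMap (λ B → powerSum (c ∷ (S ∪ B)) (inside ∷ T)) L
    ≋ map (c ∷_) (powerSumOver S T L) +ᴾ map (inside ∷_) (powerSumOver S T L)
concatMap-powerSum-inside {n} c S T L = begin
  concatMap (λ B → powerSum (c ∷ (S ∪ B)) (inside ∷ T)) L
    ≡⟨ concatMap-cong (λ B → powerSum-inside c (S ∪ B) T) L ⟩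
  concatMap (λ B → map (c ∷_) (powerSum (S ∪ B) T) +ᴾ map (inside ∷_) (powerSum (S ∪ B) T)) L
    ≈⟨ concatMap-+ᴾ (λ B → map (c ∷_) (powerSum (S ∪ B) T)) (λ B → map (inside ∷_) (powerSum (S ∪ B) T)) L ⟩
  concatMap (λ B → map (c ∷_) (powerSum (S ∪ B) T)) L
    +ᴾ concatMap (λ B → map (inside ∷_) (powerSum (S ∪ B) T)) L
    ≡⟨ cong₂ _+ᴾ_ (map-concatMap (c ∷_) _ L) (map-concatMap (inside ∷_) _ L) ⟨
  map (c ∷_) (powerSumOver S T L) +ᴾ map (inside ∷_) (powerSumOver S T L) ∎
  where open SetoidReasoning (≋-setoid (suc n))

Disjoint-∷⁻ : ∀ {n} {a b} {T V : Subset n} → Disjoint (a ∷ T) (b ∷ V) → Disjoint T V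
Disjoint-∷⁻ disj x∈T x∈V = disj (there x∈T) (there x∈V)

powerSum-inside-cong : ∀ {n} s (S U : Subset n) {R} → powerSum S U ≋ R →
  powerSum (s ∷ S) (inside ∷ U) ≋ map (s ∷_) R +ᴾ map (inside ∷_) R
powerSum-inside-cong s S U {R} eq = begin
  powerSum (s ∷ S) (inside ∷ U)
    ≡⟨ powerSum-inside s S U ⟩
  map (s ∷_) (powerSum S U) +ᴾ map (inside ∷_) (powerSum S U)
    ≈⟨ +ᴾ-cong (map-∷-cong s eq) (map-∷-cong inside eq) ⟩
  map (s ∷_) R +ᴾ map (inside ∷_) R ∎
  where open SetoidReasoning (≋-setoid _)

powerSum-∪ : ∀ {n} (S T V : Subset n) → Disjoint T V →
  powerSum S (T ∪ V) ≋ powerSumOver S T (subsetsOf V)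
powerSum-∪ [] [] [] _ = ≡⇒≋ refl
powerSum-∪ (s ∷ S) (outside ∷ T) (outside ∷ V) disj = begin
  powerSum (s ∷ S) (outside ∷ (T ∪ V))
    ≡⟨ powerSum-outside s S (T ∪ V) ⟩
  map (s ∷_) (powerSum S (T ∪ V))
    ≈⟨ map-∷-cong s (powerSum-∪ S T V (Disjoint-∷⁻ disj)) ⟩
  map (s ∷_) (powerSumOver S T (subsetsOf V))
    ≡⟨ sym (concatMap-powerSum-outside s S T (subsetsOf V)) ⟩
  concatMap (λ B → powerSum (s ∷ (S ∪ B)) (outside ∷ T)) (subsetsOf V)
    ≡⟨ sym (powerSumOver-map-outside s S outside T (subsetsOf V)) ⟩
  powerSumOver (s ∷ S) (outside ∷ T) (subsetsOf (outside ∷ V)) ∎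
  where open SetoidReasoning (≋-setoid _)
powerSum-∪ (s ∷ S) (inside ∷ T) (outside ∷ V) disj = begin
  powerSum (s ∷ S) (inside ∷ (T ∪ V))
    ≈⟨ powerSum-inside-cong s S (T ∪ V) (powerSum-∪ S T V (Disjoint-∷⁻ disj)) ⟩
  map (s ∷_) (powerSumOver S T (subsetsOf V)) +ᴾ map (inside ∷_) (powerSumOver S T (subsetsOf V))
    ≈⟨ concatMap-powerSum-inside s S T (subsetsOf V) ⟨
  concatMap (λ B → powerSum (s ∷ (S ∪ B)) (inside ∷ T)) (subsetsOf V)
    ≡⟨ sym (powerSumOver-map-outside s S inside T (subsetsOf V)) ⟩
  powerSumOver (s ∷ S) (inside ∷ T) (subsetsOf (outside ∷ V)) ∎
  where open SetoidReasoning (≋-setoid _)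
powerSum-∪ (s ∷ S) (outside ∷ T) (inside ∷ V) disj = begin
  powerSum (s ∷ S) (inside ∷ (T ∪ V))
    ≈⟨ powerSum-inside-cong s S (T ∪ V) (powerSum-∪ S T V (Disjoint-∷⁻ disj)) ⟩
  map (s ∷_) (powerSumOver S T (subsetsOf V)) +ᴾ map (inside ∷_) (powerSumOver S T (subsetsOf V))
    ≡⟨ cong₂ _+ᴾ_ (concatMap-powerSum-outside s S T (subsetsOf V))
                  (concatMap-powerSum-outside inside S T (subsetsOf V)) ⟨
  concatMap (λ B → powerSum (s ∷ (S ∪ B)) (outside ∷ T)) (subsetsOf V)
    +ᴾ concatMap (λ B → powerSum (inside ∷ (S ∪ B)) (outside ∷ T)) (subsetsOf V)
    ≡⟨ cong₂ _+ᴾ_ (powerSumOver-map-outside s S outside T (subsetsOf V))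
                  (powerSumOver-map-inside s S outside T (subsetsOf V)) ⟨
  powerSumOver (s ∷ S) (outside ∷ T) (map (outside ∷_) (subsetsOf V))
    +ᴾ powerSumOver (s ∷ S) (outside ∷ T) (map (inside ∷_) (subsetsOf V))
    ≡⟨ concatMap-++ _ (map (outside ∷_) (subsetsOf V)) _ ⟨
  powerSumOver (s ∷ S) (outside ∷ T) (subsetsOf (inside ∷ V)) ∎
  where open SetoidReasoning (≋-setoid _)
powerSum-∪ (s ∷ S) (inside ∷ T) (inside ∷ V) disj with () ← disj here here


⟦⨄pt⊎ᵖ⟧ : ∀ {n} {A : Set} (f : A → PowerTerm n) xs (ρ : PTPoly n) →
  ⟦ ⨄ xs (pt ∘ f) ⊎ᵖ ρ ⟧ ≡ concatMap (⟦_⟧ᵗ ∘ f) xs +ᴾ ⟦ ρ ⟧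
⟦⨄pt⊎ᵖ⟧ f []       ρ = refl
⟦⨄pt⊎ᵖ⟧ f (x ∷ xs) ρ =
  trans (cong (⟦ f x ⟧ᵗ ++_) (⟦⨄pt⊎ᵖ⟧ f xs ρ)) (sym (++-assoc ⟦ f x ⟧ᵗ _ ⟦ ρ ⟧))

⟦∙P⊥⟧ : ∀ {n} (X : Subset n) → ⟦ X ∙P ⊥ ⟧ᵗ ≡ X ∷ []
⟦∙P⊥⟧ {n} X = trans (cong (map (X ∪_)) (P-⊥ n)) (cong (_∷ []) (∪-identityʳ X))

⟦∙P-singleton⟧ : ∀ {n} (X : Subset n) {U : Subset n} → ∣ U ∣ ≡ 1 → ⟦ X ∙P U ⟧ᵗ ≡ X ∪ U ∷ []
⟦∙P-singleton⟧ X ∣U∣≡1 = cong (map (X ∪_)) (P-singleton ∣U∣≡1)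

map≡concatMap : ∀ {A B : Set} (f : A → B) xs → map f xs ≡ concatMap (λ x → f x ∷ []) xs
map≡concatMap f xs = sym (trans (sym (concatMap-map (_∷ []) f xs)) (concatMap-pure (map f xs)))

⟦∙P-∪⟧ : ∀ {n} (S T V : Subset n) → Disjoint T V → T ≢ ⊥ → V ≢ ⊥ →
  ⟦ pt (S ∙P (T ∪ V)) ⟧ ≋ ⟦ ⨄ (P V) (λ Ṽ → pt ((S ∪ Ṽ) ∙P T)) ⊎ᵖ pt (S ∙P T) ⊎ᵖ pt (S ∙P V) ⟧
⟦∙P-∪⟧ {n} S T V disj T≢⊥ V≢⊥ = ∙-cancelˡ (S ∷ []) _ _ (begin
  S ∷ ⟦ S ∙P (T ∪ V) ⟧ᵗ ++ []
    ≡⟨ cong (S ∷_) (++-identityʳ _) ⟩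
  S ∷ ⟦ S ∙P (T ∪ V) ⟧ᵗ
    ≡⟨ sym (powerSum≡∷⟦∙P⟧ S (p≢⊥⇒p∪q≢⊥ V T≢⊥)) ⟩
  powerSum S (T ∪ V)
    ≈⟨ powerSum-∪ S T V disj ⟩
  powerSumOver S T (subsetsOf V)
    ≡⟨ cong (powerSumOver S T) (subsetsOf≡⊥∷P V≢⊥) ⟩
  powerSum (S ∪ ⊥) T +ᴾ powerSumOver S T (P V)
    ≡⟨ cong₂ _+ᴾ_ (trans (cong (λ X → powerSum X T) (∪-identityʳ S)) (powerSum≡∷⟦∙P⟧ S T≢⊥))
                  (concatMap-cong (λ B → powerSum≡∷⟦∙P⟧ (S ∪ B) T≢⊥) (P V)) ⟩
  (S ∷ ⟦ S ∙P T ⟧ᵗ) +ᴾ concatMap (λ B → S ∪ B ∷ ⟦ (S ∪ B) ∙P T ⟧ᵗ) (P V)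
    ≈⟨ +ᴾ-cong (≡⇒≋ refl) (concatMap-+ᴾ (λ B → S ∪ B ∷ []) (λ B → ⟦ (S ∪ B) ∙P T ⟧ᵗ) (P V)) ⟩
  (S ∷ ⟦ S ∙P T ⟧ᵗ) +ᴾ (concatMap (λ B → S ∪ B ∷ []) (P V) +ᴾ Σ)
    ≡⟨ cong (λ L → (S ∷ ⟦ S ∙P T ⟧ᵗ) +ᴾ (L +ᴾ Σ)) (sym (map≡concatMap (S ∪_) (P V))) ⟩
  (S ∷ ⟦ S ∙P T ⟧ᵗ) +ᴾ (⟦ S ∙P V ⟧ᵗ +ᴾ Σ)
    ≈⟨ solve 4 (λ a b c d → (a ⊕ b) ⊕ (c ⊕ d) ⊜ a ⊕ (d ⊕ (b ⊕ (c ⊕ id)))) (≡⇒≋ refl)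
               (S ∷ []) ⟦ S ∙P T ⟧ᵗ ⟦ S ∙P V ⟧ᵗ Σ ⟩
  S ∷ Σ +ᴾ ⟦ pt (S ∙P T) ⊎ᵖ pt (S ∙P V) ⟧
    ≡⟨ cong (S ∷_) (⟦⨄pt⊎ᵖ⟧ f (P V) (pt (S ∙P T) ⊎ᵖ pt (S ∙P V))) ⟨
  S ∷ ⟦ ⨄ (P V) (pt ∘ f) ⊎ᵖ pt (S ∙P T) ⊎ᵖ pt (S ∙P V) ⟧ ∎)
  where
  open SetoidReasoning (≋-setoid n)
  open PolySolver n using (solve; _⊜_; _⊕_; id)
  open GroupProperties (AbelianGroup.group (+ᴾ-abelianGroup n)) using (∙-cancelˡ)
  f : Subset n → PowerTerm n
  f Ṽ = (S ∪ Ṽ) ∙P T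
  Σ : BoolPoly n
  Σ = concatMap (⟦_⟧ᵗ ∘ f) (P V)

⟦∙P-∪-singletonʳ⟧ : ∀ {n} (S T V : Subset n) → Disjoint T V → T ≢ ⊥ → ∣ V ∣ ≡ 1 →
  ⟦ pt (S ∙P (T ∪ V)) ⟧ ≋ ⟦ pt (S ∙P T) ⊎ᵖ pt ((S ∪ V) ∙P T) ⊎ᵖ pt ((S ∪ V) ∙P ⊥) ⟧
⟦∙P-∪-singletonʳ⟧ {n} S T V disj T≢⊥ ∣V∣≡1 = begin
  ⟦ pt (S ∙P (T ∪ V)) ⟧
    ≈⟨ ⟦∙P-∪⟧ S T V disj T≢⊥ (1≤∣p∣⇒p≢⊥ (≤-reflexive (sym ∣V∣≡1))) ⟩
  ⟦ ⨄ (P V) (λ Ṽ → pt ((S ∪ Ṽ) ∙P T)) ⊎ᵖ pt (S ∙P T) ⊎ᵖ pt (S ∙P V) ⟧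
    ≡⟨ cong (λ L → ⟦ ⨄ L (λ Ṽ → pt ((S ∪ Ṽ) ∙P T)) ⊎ᵖ pt (S ∙P T) ⊎ᵖ pt (S ∙P V) ⟧) (P-singleton ∣V∣≡1) ⟩
  ⟦ (S ∪ V) ∙P T ⟧ᵗ +ᴾ (⟦ S ∙P T ⟧ᵗ +ᴾ (⟦ S ∙P V ⟧ᵗ +ᴾ []))
    ≡⟨ cong (λ M → ⟦ (S ∪ V) ∙P T ⟧ᵗ +ᴾ (⟦ S ∙P T ⟧ᵗ +ᴾ (M +ᴾ []))) (⟦∙P-singleton⟧ S ∣V∣≡1) ⟩
  ⟦ (S ∪ V) ∙P T ⟧ᵗ +ᴾ (⟦ S ∙P T ⟧ᵗ +ᴾ (S ∪ V ∷ []))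
    ≈⟨ solve 3 (λ a b c → a ⊕ (b ⊕ c) ⊜ b ⊕ (a ⊕ c)) (≡⇒≋ refl)
               ⟦ (S ∪ V) ∙P T ⟧ᵗ ⟦ S ∙P T ⟧ᵗ (S ∪ V ∷ []) ⟩
  ⟦ S ∙P T ⟧ᵗ +ᴾ (⟦ (S ∪ V) ∙P T ⟧ᵗ +ᴾ (S ∪ V ∷ []))
    ≡⟨ cong (λ M → ⟦ S ∙P T ⟧ᵗ +ᴾ (⟦ (S ∪ V) ∙P T ⟧ᵗ +ᴾ (M +ᴾ []))) (sym (⟦∙P⊥⟧ (S ∪ V))) ⟩
  ⟦ pt (S ∙P T) ⊎ᵖ pt ((S ∪ V) ∙P T) ⊎ᵖ pt ((S ∪ V) ∙P ⊥) ⟧ ∎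
  where
  open SetoidReasoning (≋-setoid n)
  open PolySolver n using (solve; _⊜_; _⊕_)

⟦∙P-∪-singletons⟧ : ∀ {n} (S T V : Subset n) → Disjoint T V → ∣ T ∣ ≡ 1 → ∣ V ∣ ≡ 1 →
  ⟦ pt (S ∙P (T ∪ V)) ⟧ ≋ ⟦ pt ((S ∪ T) ∙P ⊥) ⊎ᵖ pt ((S ∪ T ∪ V) ∙P ⊥) ⊎ᵖ pt ((S ∪ V) ∙P ⊥) ⟧
⟦∙P-∪-singletons⟧ {n} S T V disj ∣T∣≡1 ∣V∣≡1 = begin
  ⟦ pt (S ∙P (T ∪ V)) ⟧
    ≈⟨ ⟦∙P-∪-singletonʳ⟧ S T V disj (1≤∣p∣⇒p≢⊥ (≤-reflexive (sym ∣T∣≡1))) ∣V∣≡1 ⟩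
  ⟦ S ∙P T ⟧ᵗ +ᴾ (⟦ (S ∪ V) ∙P T ⟧ᵗ +ᴾ ⟦ pt ((S ∪ V) ∙P ⊥) ⟧)
    ≡⟨ cong₂ (λ A B → A +ᴾ (B +ᴾ ⟦ pt ((S ∪ V) ∙P ⊥) ⟧))
             (trans (⟦∙P-singleton⟧ S ∣T∣≡1) (sym (⟦∙P⊥⟧ (S ∪ T))))
             (trans (⟦∙P-singleton⟧ (S ∪ V) ∣T∣≡1)
                    (trans (cong (_∷ []) S∪V∪T≡S∪T∪V) (sym (⟦∙P⊥⟧ (S ∪ T ∪ V))))) ⟩
  ⟦ pt ((S ∪ T) ∙P ⊥) ⊎ᵖ pt ((S ∪ T ∪ V) ∙P ⊥) ⊎ᵖ pt ((S ∪ V) ∙P ⊥) ⟧ ∎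
  where
  open SetoidReasoning (≋-setoid n)
  S∪V∪T≡S∪T∪V : (S ∪ V) ∪ T ≡ S ∪ T ∪ V
  S∪V∪T≡S∪T∪V = trans (∪-assoc S V T) (cong (S ∪_) (∪-comm V T))

mainTheorem3 : ∀ (n : ℕ) (S T V : Subset n) →
    Disjoint S T → Disjoint S V → Disjoint T V →
    1 ≤ ∣ T ∣ → 1 ≤ ∣ V ∣ →
    ((∣ T ∣ ≡ 1 → ∣ V ∣ ≡ 1 →
        ⟦ pt (S ∙P (T ∪ V)) ⟧
          ≈ ⟦ pt ((S ∪ T) ∙P ⊥) ⊎ᵖ pt ((S ∪ T ∪ V) ∙P ⊥) ⊎ᵖ pt ((S ∪ V) ∙P ⊥) ⟧)
    × (1 < ∣ T ∣ → ∣ V ∣ ≡ 1 →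
        ⟦ pt (S ∙P (T ∪ V)) ⟧
          ≈ ⟦ pt (S ∙P T) ⊎ᵖ pt ((S ∪ V) ∙P T) ⊎ᵖ pt ((S ∪ V) ∙P ⊥) ⟧)
    × (1 < ∣ T ∣ → 1 < ∣ V ∣ →
        ⟦ pt (S ∙P (T ∪ V)) ⟧
          ≈ ⟦ ⨄ (P V) (λ Ṽ → pt ((S ∪ Ṽ) ∙P T)) ⊎ᵖ pt (S ∙P T) ⊎ᵖ pt (S ∙P V) ⟧))
mainTheorem3 n S T V _ _ disj 1≤∣T∣ 1≤∣V∣ =
    (λ ∣T∣≡1 ∣V∣≡1 → ≋⇒≈ (⟦∙P-∪-singletons⟧ S T V disj ∣T∣≡1 ∣V∣≡1))
  , (λ _ ∣V∣≡1 → ≋⇒≈ (⟦∙P-∪-singletonʳ⟧ S T V disj T≢⊥ ∣V∣≡1))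
  , (λ _ _ → ≋⇒≈ (⟦∙P-∪⟧ S T V disj T≢⊥ (1≤∣p∣⇒p≢⊥ 1≤∣V∣)))
  where
  T≢⊥ : T ≢ ⊥
  T≢⊥ = 1≤∣p∣⇒p≢⊥ 1≤∣T∣
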